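{- Let $q$ be a prime and $k\ge1$ an integer. For every positive integer $n$, $q$ divides $\sigma_k(n)$ if and only if $q$ divides $\sigma_{(k,q-1)}(n)$.
   Context: $\sigma_k(n)=\sum_{d\mid n}d^k$ and $(k,q-1)$ denotes the greatest common divisor. -}

module Defs where

open import Data.Nat using (ℕ; suc; _^_)
open import Data.Nat.Divisibility using (_∣?_)
open import Data.List using (List; filter; map; applyUpTo)
open import Data.Nat.ListAction using (sum)

divisors : ℕ → List ℕ
divisors n = filter (_∣? n) (applyUpTo suc n)

σ : ℕ → ℕ → ℕ
σ k n = sum (map (_^ k) (divisors n))

-- σ_k is multiplicative, so by Euclid's lemma q divides σ_k(n) iff it divides σ_k(p ^ a) for
-- some prime power p ^ a exactly dividing n; hence it suffices to compare σ_k and σ_g, where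
-- g = gcd k (q - 1), on prime powers. There σ_k(p ^ a) = 1 + y + ⋯ + y ^ a with y = p ^ k.
-- If y ≡ 1 (mod q) this sum is ≡ a + 1; otherwise (y - 1) times it is y ^ (a + 1) - 1, so q
-- divides it iff y ^ (a + 1) ≡ 1. Either way divisibility depends only on which powers of y
-- are ≡ 1, and these agree for y = p ^ k and y = p ^ g: if q ∣ p both are ≡ 0, and otherwise
-- p ^ (k j) ≡ 1 iff p ^ (g j) ≡ 1, by Fermat's little theorem and Bézout's identity.

module Submission where

open import Defs
open import Data.Nat using (ℕ; _∸_; _≤_; _<_)
open import Data.Nat.Divisibility using (_∣_)
open import Data.Nat.GCD using (gcd)
open import Data.Nat.Primality using (Prime)
open import Function.Bundles using (_⇔_)

open import Data.Empty using (⊥-elim)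
open import Data.List
  using (List; []; _∷_; _++_; map; length; applyUpTo; downFrom; cartesianProduct)
open import Data.List.Membership.Propositional using (_∈_)
open import Data.List.Membership.Propositional.Properties
  using (∈-∃++; ∈-map⁺; ∈-map⁻; ∈-applyUpTo⁺; ∈-applyUpTo⁻; ∈-filter⁺; ∈-filter⁻;
         ∈-downFrom⁺; ∈-downFrom⁻; ∈-cartesianProduct⁺; ∈-cartesianProduct⁻)
open import Data.List.Properties
  using (map-++; map-∘; length-++; length-map; length-applyUpTo; ++-identityʳ)
open import Data.List.Relation.Binary.Permutation.Propositional
  using (_↭_; prep; ↭-refl; ↭-reflexive; ↭-trans; ↭-sym)
open import Data.List.Relation.Binary.Permutation.Propositional.Properties as ↭
  using (shift; ∈-resp-↭; ↭-length)
open import Data.List.Relation.Binary.Subset.Propositional using (_⊆_)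
open import Data.List.Relation.Unary.All as All using (All; []; _∷_)
import Data.List.Relation.Unary.All.Properties as All
open import Data.List.Relation.Unary.AllPairs using ([]; _∷_)
open import Data.List.Relation.Unary.Any using (here; there)
open import Data.List.Relation.Unary.Unique.Propositional using (Unique)
open import Data.List.Relation.Unary.Unique.Propositional.Properties as Unique
  using (applyUpTo⁺₁; filter⁺; downFrom⁺)
open import Data.Nat
  using (zero; suc; _+_; _*_; _^_; z≤n; s≤s; s≤s⁻¹; z<s;
         NonZero; ≢-nonZero; ≢-nonZero⁻¹; >-nonZero; nonTrivial⇒n>1)
open import Data.Nat.Coprimality as Coprimality using (Coprime; coprime-divisor; coprime-/gcd)
open import Data.Nat.Divisibility
  using (divides; _∣?_; _∣0; ∣-trans; ∣-antisym; ∣1⇒≡1; 0∣⇒≡0; ∣⇒≤; >⇒∤; m∣m*n; ∣m⇒∣m*n;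
         ∣n⇒∣m*n; *-pres-∣; *-monoˡ-∣; *-cancelˡ-∣; m%n≡0⇒n∣m; n∣m⇒m%n≡0)
open import Data.Nat.DivMod
open import Data.Nat.GCD
  using (gcd[m,n]∣m; gcd[m,n]∣n; gcd[m,n]≢0; gcd-GCD; c*gcd[m,n]≡gcd[cm,cn]; module Bézout)
open import Data.Nat.Induction using (<-rec)
open import Data.Nat.ListAction using (sum; product)
open import Data.Nat.ListAction.Properties using (sum-↭; sum-++; product-↭)
open import Data.Nat.Primality
  using (prime[2]; ¬prime[1]; prime⇒nonZero; prime⇒nonTrivial; prime⇒irreducible; euclidsLemma)
open import Data.Nat.Primality.Factorisation using (factorise)
open import Data.Nat.Properties
open import Algebra.Properties.CommutativeSemigroup *-commutativeSemigroup using (interchange)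
open import Data.Nat.Tactic.RingSolver using (solve-∀)
open import Data.Product using (∃; ∃₂; _×_; _,_; proj₁; proj₂; uncurry)
open import Data.Sum using (_⊎_; inj₁; inj₂; [_,_]′)
open import Function.Base using (_∘_; id)
open import Function.Bundles using (mk⇔; Equivalence)
open import Function.Construct.Composition using (_⇔-∘_)
open import Function.Construct.Symmetry using (⇔-sym)
open import Relation.Binary.Definitions using (tri<; tri≈; tri>)
open import Relation.Binary.PropositionalEquality
open import Relation.Nullary using (¬_; yes; no)

module _ {a} {A : Set a} where

  ⊆-cancel-∷ : ∀ {x : A} {xs ys ws} → All (x ≢_) xs → ys ↭ x ∷ ws → x ∷ xs ⊆ ys → xs ⊆ ws
  ⊆-cancel-∷ x∉xs p xs⊆ys z∈xs with ∈-resp-↭ p (xs⊆ys (there z∈xs))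
  ... | here refl  = ⊥-elim (All.lookup x∉xs z∈xs refl)
  ... | there z∈ws = z∈ws

  Unique-⊆⇒↭-++ : {xs ys : List A} → Unique xs → xs ⊆ ys → ∃ λ zs → ys ↭ xs ++ zs
  Unique-⊆⇒↭-++ {[]}     {ys} []           _     = ys , ↭-refl
  Unique-⊆⇒↭-++ {x ∷ xs} {ys} (x∉xs ∷ !xs) xs⊆ys
    with us , vs , refl ← ∈-∃++ (xs⊆ys (here refl))
    with zs , p ← Unique-⊆⇒↭-++ !xs (⊆-cancel-∷ x∉xs (shift x us vs) xs⊆ys)
    = zs , ↭-trans (shift x us vs) (prep x p)

  length-↭-++ : {xs ys zs : List A} → ys ↭ xs ++ zs → length ys ≡ length xs + length zs
  length-↭-++ {xs} p = trans (↭-length p) (length-++ xs)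

  Unique-⊆⇒length≤ : {xs ys : List A} → Unique xs → xs ⊆ ys → length xs ≤ length ys
  Unique-⊆⇒length≤ {xs} !xs xs⊆ys with zs , p ← Unique-⊆⇒↭-++ !xs xs⊆ys =
    subst (length xs ≤_) (sym (length-↭-++ {xs} p)) (m≤m+n (length xs) (length zs))

  Unique-⊆-length≤⇒↭ : {xs ys : List A} → Unique xs → xs ⊆ ys → length ys ≤ length xs → xs ↭ ys
  Unique-⊆-length≤⇒↭ {xs} !xs xs⊆ys ys≤xs with Unique-⊆⇒↭-++ !xs xs⊆ys
  ... | [] , p = ↭-sym (↭-trans p (↭-reflexive (++-identityʳ xs)))
  ... | z ∷ zs , p = ⊥-elim (m+1+n≰m (length xs) (subst (_≤ length xs) (length-↭-++ {xs} p) ys≤xs))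

  Unique-⊆-⊇⇒↭ : {xs ys : List A} → Unique xs → Unique ys → xs ⊆ ys → ys ⊆ xs → xs ↭ ys
  Unique-⊆-⊇⇒↭ !xs !ys xs⊆ys ys⊆xs =
    Unique-⊆-length≤⇒↭ !xs xs⊆ys (Unique-⊆⇒length≤ !ys ys⊆xs)

  Unique-map⁺-local : ∀ {b} {B : Set b} {f : A → B} {xs : List A} →
                (∀ {x y} → x ∈ xs → y ∈ xs → f x ≡ f y → x ≡ y) →
                Unique xs → Unique (map f xs)
  Unique-map⁺-local {xs = []}     f-inj []           = []
  Unique-map⁺-local {xs = x ∷ xs} f-inj (x∉xs ∷ !xs) =
    All.map⁺ (All.tabulate λ y∈xs fx≡fy →
      All.lookup x∉xs y∈xs (f-inj (here refl) (there y∈xs) fx≡fy))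
    ∷ Unique-map⁺-local (λ x∈ y∈ → f-inj (there x∈) (there y∈)) !xs

^-distribʳ-* : ∀ x y n → (x * y) ^ n ≡ x ^ n * y ^ n
^-distribʳ-* x y zero    = refl
^-distribʳ-* x y (suc n) = begin
  x * y * (x * y) ^ n       ≡⟨ cong (x * y *_) (^-distribʳ-* x y n) ⟩
  x * y * (x ^ n * y ^ n)   ≡⟨ interchange x y (x ^ n) (y ^ n) ⟩
  x * x ^ n * (y * y ^ n)   ∎
  where open ≡-Reasoning

^-injective : ∀ {x} → 1 < x → ∀ {i j} → x ^ i ≡ x ^ j → i ≡ j
^-injective {x} 1<x {i} {j} x^i≡x^j with <-cmp i j
... | tri< i<j _ _ = ⊥-elim (<⇒≢ (^-monoʳ-< x 1<x i<j) x^i≡x^j)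
... | tri≈ _ i≡j _ = i≡j
... | tri> _ _ j<i = ⊥-elim (<⇒≢ (^-monoʳ-< x 1<x j<i) (sym x^i≡x^j))

^-monoʳ-∣ : ∀ x {i j} → i ≤ j → x ^ i ∣ x ^ j
^-monoʳ-∣ x {i} {j} i≤j = divides (x ^ (j ∸ i)) (begin
  x ^ j             ≡⟨ cong (x ^_) (m∸n+n≡m i≤j) ⟨
  x ^ (j ∸ i + i)   ≡⟨ ^-distribˡ-+-* x (j ∸ i) i ⟩
  x ^ (j ∸ i) * x ^ i ∎)
  where open ≡-Reasoning

∣⇒∣^ : ∀ {d x} e → .{{NonZero e}} → d ∣ x → d ∣ x ^ e
∣⇒∣^ {x = x} (suc e) d∣x = ∣m⇒∣m*n (x ^ e) d∣x

product-map-*ˡ : ∀ a xs → product (map (a *_) xs) ≡ a ^ length xs * product xs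
product-map-*ˡ a []       = refl
product-map-*ˡ a (x ∷ xs) = begin
  a * x * product (map (a *_) xs)        ≡⟨ cong (a * x *_) (product-map-*ˡ a xs) ⟩
  a * x * (a ^ length xs * product xs)   ≡⟨ interchange a x (a ^ length xs) (product xs) ⟩
  a * a ^ length xs * (x * product xs)   ∎
  where open ≡-Reasoning

prime∤⇒coprime : ∀ {p n} → Prime p → ¬ p ∣ n → Coprime p n
prime∤⇒coprime p-prime p∤n (c∣p , c∣n) with prime⇒irreducible p-prime c∣p
... | inj₁ c≡1    = c≡1
... | inj₂ refl   = ⊥-elim (p∤n c∣n)

∣p^a⇒≡p^i : ∀ {p} → Prime p → ∀ a {d} → d ∣ p ^ a → ∃ λ i → i ≤ a × d ≡ p ^ i
∣p^a⇒≡p^i p-prime zero    d∣1 = 0 , z≤n , ∣1⇒≡1 d∣1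
∣p^a⇒≡p^i {p} p-prime (suc a) {d} d∣p^[1+a] with p ∣? d
... | yes (divides e refl)
  with i , i≤a , refl ← ∣p^a⇒≡p^i p-prime a
         (*-cancelˡ-∣ p {{prime⇒nonZero p-prime}} (subst (_∣ p * p ^ a) (*-comm e p) d∣p^[1+a]))
  = suc i , s≤s i≤a , *-comm (p ^ i) p
... | no p∤d
  with i , i≤a , d≡p^i ← ∣p^a⇒≡p^i p-prime a
         (coprime-divisor (Coprimality.sym (prime∤⇒coprime p-prime p∤d)) d∣p^[1+a])
  = i , m≤n⇒m≤1+n i≤a , d≡p^i

prime^∤⇒coprime : ∀ {p} → Prime p → ∀ a {m} → ¬ p ∣ m → Coprime (p ^ a) m
prime^∤⇒coprime p-prime a p∤m (c∣p^a , c∣m) with ∣p^a⇒≡p^i p-prime a c∣p^a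
... | zero  , _ , c≡1 = c≡1
... | suc i , _ , refl = ⊥-elim (p∤m (∣-trans (m∣m*n _) c∣m))

∃prime∣ : ∀ {n} → 1 < n → ∃ λ p → Prime p × p ∣ n
∃prime∣ {n} 1<n with factorise n {{>-nonZero (<-trans z<s 1<n)}}
... | record { factors = [] ; isFactorisation = n≡1 } = ⊥-elim (<⇒≢ 1<n (sym n≡1))
... | record { factors = p ∷ ps ; isFactorisation = n≡p*P ; factorsPrime = p-prime ∷ _ } =
  p , p-prime , divides (product ps) (trans n≡p*P (*-comm p (product ps)))

p-adicSplit : ∀ {p} → Prime p → ∀ n → .{{NonZero n}} → ∃₂ λ a m → ¬ p ∣ m × n ≡ p ^ a * m
p-adicSplit {p} p-prime = <-rec _ split
  where
  1<p : 1 < p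
  1<p = nonTrivial⇒n>1 p {{prime⇒nonTrivial p-prime}}

  split : ∀ n → (∀ {m} → m < n → .{{NonZero m}} → ∃₂ λ a r → ¬ p ∣ r × m ≡ p ^ a * r) →
          .{{NonZero n}} → ∃₂ λ a m → ¬ p ∣ m × n ≡ p ^ a * m
  split n rec with p ∣? n
  ... | no p∤n = 0 , n , p∤n , sym (*-identityˡ n)
  ... | yes (divides m refl)
    with a , r , p∤r , refl ← rec (m<m*n m p {{m*n≢0⇒m≢0 m}} 1<p) {{m*n≢0⇒m≢0 m}} =
    suc a , r , p∤r , trans (*-comm (p ^ a * r) p) (sym (*-assoc p (p ^ a) r))

prime-power-factor : ∀ {n} → 1 < n → ∃ λ p → ∃₂ λ a m → Prime p × ¬ p ∣ m × n ≡ p ^ suc a * m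
prime-power-factor {n} 1<n
  with p , p-prime , p∣n ← ∃prime∣ 1<n
  with p-adicSplit p-prime n {{>-nonZero (<-trans z<s 1<n)}}
... | zero  , m , p∤m , n≡1*m = ⊥-elim (p∤m (subst (p ∣_) (trans n≡1*m (*-identityˡ m)) p∣n))
... | suc a , m , p∤m , n≡p^[1+a]*m = p , a , m , p-prime , p∤m , n≡p^[1+a]*m

Multiplicative : (ℕ → ℕ) → Set
Multiplicative f = ∀ {a b} → .{{NonZero a}} → .{{NonZero b}} → Coprime a b → f (a * b) ≡ f a * f b

∣-transfer-multiplicative : ∀ {q f g} → Prime q → Multiplicative f → Multiplicative g →
                            (∀ {p} → Prime p → ∀ a → q ∣ f (p ^ a) → q ∣ g (p ^ a)) →
                            ∀ n → .{{NonZero n}} → q ∣ f n → q ∣ g n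
∣-transfer-multiplicative {q} {f} {g} q-prime f-mult g-mult prime-powers = <-rec _ transfer
  where
  transfer-p^[1+a]*m : ∀ {p m} → Prime p → ¬ p ∣ m → .{{NonZero m}} → ∀ a →
                  (q ∣ f m → q ∣ g m) → q ∣ f (p ^ suc a * m) → q ∣ g (p ^ suc a * m)
  transfer-p^[1+a]*m {p} {m} p-prime p∤m a ih q∣f[p^a*m] =
    subst (q ∣_) (sym (g-mult p^a⊥m))
      ([ ∣m⇒∣m*n (g m) ∘ prime-powers p-prime (suc a) , ∣n⇒∣m*n (g (p ^ suc a)) ∘ ih ]′
        (euclidsLemma (f (p ^ suc a)) (f m) q-prime (subst (q ∣_) (f-mult p^a⊥m) q∣f[p^a*m])))
    where
    instance
      p^a≢0 : NonZero (p ^ suc a)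
      p^a≢0 = m^n≢0 p (suc a) {{prime⇒nonZero p-prime}}
    p^a⊥m : Coprime (p ^ suc a) m
    p^a⊥m = prime^∤⇒coprime p-prime (suc a) p∤m

  transfer : ∀ n → (∀ {m} → m < n → .{{NonZero m}} → q ∣ f m → q ∣ g m) →
             .{{NonZero n}} → q ∣ f n → q ∣ g n
  transfer zero             _   = ⊥-elim (≢-nonZero⁻¹ 0 refl)
  transfer (suc zero)       _   = prime-powers prime[2] 0   -- 1 = 2 ^ 0
  transfer n@(suc (suc _)) rec q∣fn
    with p , a , m , p-prime , p∤m , n≡p^[1+a]*m ← prime-power-factor {n} (s≤s (s≤s z≤n)) =
    subst (q ∣_) (cong g (sym n≡p^[1+a]*m))
      (transfer-p^[1+a]*m p-prime p∤m a (rec m<n) (subst (q ∣_) (cong f n≡p^[1+a]*m) q∣fn))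
    where
    instance
      m≢0 : NonZero m
      m≢0 = ≢-nonZero λ { refl → p∤m (p ∣0) }

    1<p^[1+a] : 1 < p ^ suc a
    1<p^[1+a] = ^-monoʳ-< p (nonTrivial⇒n>1 p {{prime⇒nonTrivial p-prime}}) {0} {suc a} z<s

    m<n : m < n
    m<n = subst (m <_) (trans (*-comm m (p ^ suc a)) (sym n≡p^[1+a]*m))
      (m<m*n m (p ^ suc a) 1<p^[1+a])

geometricSum : ℕ → ℕ → ℕ
geometricSum y zero    = 1
geometricSum y (suc a) = y ^ suc a + geometricSum y a

-- (y - 1) * geometricSum y a = y ^ (1 + a) - 1, rearranged to avoid subtraction
geometricSum-telescope : ∀ y a → 1 + geometricSum y a * y ≡ geometricSum y a + y ^ suc a
geometricSum-telescope y zero    = cong suc (*-comm 1 y)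
geometricSum-telescope y (suc a) = begin
  1 + (y ^ suc a + G) * y         ≡⟨ distribute (y ^ suc a) G y ⟩
  y ^ suc a * y + (1 + G * y)     ≡⟨ cong (y ^ suc a * y +_) (geometricSum-telescope y a) ⟩
  y ^ suc a * y + (G + y ^ suc a) ≡⟨ regroup (y ^ suc a) G y ⟩
  y ^ suc a + G + y * y ^ suc a   ∎
  where
  open ≡-Reasoning
  G : ℕ
  G = geometricSum y a
  distribute : ∀ u g y → 1 + (u + g) * y ≡ u * y + (1 + g * y)
  distribute = solve-∀
  regroup : ∀ u g y → u * y + (g + u) ≡ u + g + y * u
  regroup = solve-∀

powerSum : ℕ → List ℕ → ℕ
powerSum k xs = sum (map (_^ k) xs)

powerSum-↭ : ∀ k {xs ys} → xs ↭ ys → powerSum k xs ≡ powerSum k ys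
powerSum-↭ k xs↭ys = sum-↭ (↭.map⁺ (_^ k) xs↭ys)

powerSum-powers : ∀ x k a → powerSum k (map (x ^_) (downFrom (suc a))) ≡ geometricSum (x ^ k) a
powerSum-powers x k zero    = cong (_+ 0) (^-zeroˡ k)
powerSum-powers x k (suc a) = cong₂ _+_ x^[1+a]^k≡x^k^[1+a] (powerSum-powers x k a)
  where
  x^[1+a]^k≡x^k^[1+a] : (x ^ suc a) ^ k ≡ (x ^ k) ^ suc a
  x^[1+a]^k≡x^k^[1+a] = begin
    (x ^ suc a) ^ k   ≡⟨ ^-*-assoc x (suc a) k ⟩
    x ^ (suc a * k)   ≡⟨ cong (x ^_) (*-comm (suc a) k) ⟩
    x ^ (k * suc a)   ≡⟨ ^-*-assoc x k (suc a) ⟨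
    (x ^ k) ^ suc a   ∎
    where open ≡-Reasoning

powerSum-products : ∀ k xs ys →
  powerSum k (map (uncurry _*_) (cartesianProduct xs ys)) ≡ powerSum k xs * powerSum k ys
powerSum-products k []       ys = refl
powerSum-products k (x ∷ xs) ys = begin
  powerSum k (map (uncurry _*_) (map (x ,_) ys ++ cartesianProduct xs ys))
    ≡⟨ cong (powerSum k) (map-++ (uncurry _*_) (map (x ,_) ys) (cartesianProduct xs ys)) ⟩
  powerSum k (map (uncurry _*_) (map (x ,_) ys) ++ map (uncurry _*_) (cartesianProduct xs ys))
    ≡⟨ cong (λ zs → powerSum k (zs ++ _)) (map-∘ ys) ⟨
  powerSum k (map (x *_) ys ++ map (uncurry _*_) (cartesianProduct xs ys))
    ≡⟨ cong sum (map-++ (_^ k) (map (x *_) ys) _) ⟩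
  sum (map (_^ k) (map (x *_) ys) ++ map (_^ k) (map (uncurry _*_) (cartesianProduct xs ys)))
    ≡⟨ sum-++ (map (_^ k) (map (x *_) ys)) _ ⟩
  powerSum k (map (x *_) ys) + powerSum k (map (uncurry _*_) (cartesianProduct xs ys))
    ≡⟨ cong₂ _+_ (powerSum-map-*ˡ ys) (powerSum-products k xs ys) ⟩
  x ^ k * powerSum k ys + powerSum k xs * powerSum k ys
    ≡⟨ *-distribʳ-+ (powerSum k ys) (x ^ k) (powerSum k xs) ⟨
  (x ^ k + powerSum k xs) * powerSum k ys
    ∎
  where
  open ≡-Reasoning
  powerSum-map-*ˡ : ∀ ys → powerSum k (map (x *_) ys) ≡ x ^ k * powerSum k ys
  powerSum-map-*ˡ []       = sym (*-zeroʳ (x ^ k))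
  powerSum-map-*ˡ (y ∷ ys) = trans (cong₂ _+_ (^-distribʳ-* x y k) (powerSum-map-*ˡ ys))
                                   (sym (*-distribˡ-+ (x ^ k) (y ^ k) (powerSum k ys)))

∈-divisors⁻ : ∀ n {d} → d ∈ divisors n → d ∣ n
∈-divisors⁻ n d∈ = proj₂ (∈-filter⁻ (_∣? n) {xs = applyUpTo suc n} d∈)

∈-divisors⁺ : ∀ {n d} → .{{NonZero n}} → d ∣ n → d ∈ divisors n
∈-divisors⁺ {n} {zero}  0∣n = ⊥-elim (≢-nonZero⁻¹ n (0∣⇒≡0 0∣n))
∈-divisors⁺ {n} {suc i} d∣n = ∈-filter⁺ (_∣? n) (∈-applyUpTo⁺ suc (∣⇒≤ d∣n)) d∣n

Unique-divisors : ∀ n → Unique (divisors n)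
Unique-divisors n = filter⁺ (_∣? n) (applyUpTo⁺₁ suc n (λ i<j _ → <⇒≢ i<j ∘ suc-injective))

divisors[p^a]↭ : ∀ {p} → Prime p → ∀ a → divisors (p ^ a) ↭ map (p ^_) (downFrom (suc a))
divisors[p^a]↭ {p} p-prime a = Unique-⊆-⊇⇒↭ (Unique-divisors (p ^ a))
  (Unique.map⁺ (^-injective (nonTrivial⇒n>1 p {{prime⇒nonTrivial p-prime}})) (downFrom⁺ (suc a)))
  ⊆-powers ⊇-powers
  where
  instance
    p≢0 : NonZero p
    p≢0 = prime⇒nonZero p-prime
    p^a≢0 : NonZero (p ^ a)
    p^a≢0 = m^n≢0 p a

  ⊆-powers : divisors (p ^ a) ⊆ map (p ^_) (downFrom (suc a))
  ⊆-powers d∈ with i , i≤a , refl ← ∣p^a⇒≡p^i p-prime a (∈-divisors⁻ (p ^ a) d∈) =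
    ∈-map⁺ (p ^_) (∈-downFrom⁺ (s≤s i≤a))

  ⊇-powers : map (p ^_) (downFrom (suc a)) ⊆ divisors (p ^ a)
  ⊇-powers z∈ with i , i∈ , refl ← ∈-map⁻ (p ^_) z∈ =
    ∈-divisors⁺ (^-monoʳ-∣ p (s≤s⁻¹ (∈-downFrom⁻ i∈)))

σ[p^a]≡geometricSum : ∀ {p} → Prime p → ∀ k a → σ k (p ^ a) ≡ geometricSum (p ^ k) a
σ[p^a]≡geometricSum {p} p-prime k a =
  trans (powerSum-↭ k (divisors[p^a]↭ p-prime a)) (powerSum-powers p k a)

∣-*-split : ∀ {a b c} → .{{NonZero a}} → c ∣ a * b → ∃₂ λ d e → d ∣ a × e ∣ b × c ≡ d * e
∣-*-split {a} {b} {c} c∣ab =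
  g , c / g , gcd[m,n]∣n c a , c/g∣b , sym (m*[n/m]≡n (gcd[m,n]∣m c a))
  where
  g : ℕ
  g = gcd c a
  instance
    g≢0 : NonZero g
    g≢0 = ≢-nonZero (gcd[m,n]≢0 c a (inj₂ (≢-nonZero⁻¹ a)))

  g*[c/g]∣g*[a/g*b] : g * (c / g) ∣ g * (a / g * b)
  g*[c/g]∣g*[a/g*b] = subst₂ _∣_ (sym (m*[n/m]≡n (gcd[m,n]∣m c a)))
    (trans (cong (_* b) (sym (m*[n/m]≡n (gcd[m,n]∣n c a)))) (*-assoc g (a / g) b)) c∣ab

  c/g∣b : c / g ∣ b
  c/g∣b = coprime-divisor (coprime-/gcd c a) (*-cancelˡ-∣ g g*[c/g]∣g*[a/g*b])

divisors-*-↭ : ∀ {a b} → .{{NonZero a}} → .{{NonZero b}} → Coprime a b →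
               divisors (a * b) ↭ map (uncurry _*_) (cartesianProduct (divisors a) (divisors b))
divisors-*-↭ {a} {b} a⊥b = Unique-⊆-⊇⇒↭ (Unique-divisors (a * b))
  (Unique-map⁺-local injective (Unique.cartesianProduct⁺ (Unique-divisors a) (Unique-divisors b)))
  ⊆-products ⊇-products
  where
  instance
    ab≢0 : NonZero (a * b)
    ab≢0 = m*n≢0 a b

  divisors⊥ : ∀ {d e} → d ∣ a → e ∣ b → Coprime d e
  divisors⊥ d∣a e∣b (c∣d , c∣e) = a⊥b (∣-trans c∣d d∣a , ∣-trans c∣e e∣b)

  injective : ∀ {x y} → x ∈ cartesianProduct (divisors a) (divisors b) →
              y ∈ cartesianProduct (divisors a) (divisors b) → uncurry _*_ x ≡ uncurry _*_ y → x ≡ y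
  injective {d , e} {d′ , e′} de∈ d′e′∈ de≡d′e′
    with d∈ , e∈ ← ∈-cartesianProduct⁻ (divisors a) (divisors b) de∈
       | d′∈ , e′∈ ← ∈-cartesianProduct⁻ (divisors a) (divisors b) d′e′∈
    = cong₂ _,_ d≡d′ (*-cancelˡ-≡ e e′ d {{d≢0}} (trans de≡d′e′ (cong (_* e′) (sym d≡d′))))
    where
    d∣a : d ∣ a
    d∣a = ∈-divisors⁻ a d∈
    e∣b : e ∣ b
    e∣b = ∈-divisors⁻ b e∈
    d′∣a : d′ ∣ a
    d′∣a = ∈-divisors⁻ a d′∈
    e′∣b : e′ ∣ b
    e′∣b = ∈-divisors⁻ b e′∈
    d≡d′ : d ≡ d′
    d≡d′ = ∣-antisym
      (coprime-divisor (divisors⊥ d∣a e′∣b) (subst (d ∣_) (trans de≡d′e′ (*-comm d′ e′)) (m∣m*n e)))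
      (coprime-divisor (divisors⊥ d′∣a e∣b)
        (subst (d′ ∣_) (trans (sym de≡d′e′) (*-comm d e)) (m∣m*n e′)))
    d≢0 : NonZero d
    d≢0 = ≢-nonZero λ { refl → ≢-nonZero⁻¹ a (0∣⇒≡0 d∣a) }

  ⊆-products : divisors (a * b) ⊆ map (uncurry _*_) (cartesianProduct (divisors a) (divisors b))
  ⊆-products c∈ with d , e , d∣a , e∣b , refl ← ∣-*-split (∈-divisors⁻ (a * b) c∈) =
    ∈-map⁺ (uncurry _*_) (∈-cartesianProduct⁺ (∈-divisors⁺ d∣a) (∈-divisors⁺ e∣b))

  ⊇-products : map (uncurry _*_) (cartesianProduct (divisors a) (divisors b)) ⊆ divisors (a * b)
  ⊇-products z∈ with (d , e) , de∈ , refl ← ∈-map⁻ (uncurry _*_) z∈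
                    with d∈ , e∈ ← ∈-cartesianProduct⁻ (divisors a) (divisors b) de∈ =
    ∈-divisors⁺ (*-pres-∣ (∈-divisors⁻ a d∈) (∈-divisors⁻ b e∈))

σ-multiplicative : ∀ k → Multiplicative (σ k)
σ-multiplicative k {a} {b} a⊥b =
  trans (powerSum-↭ k (divisors-*-↭ a⊥b)) (powerSum-products k (divisors a) (divisors b))

module Congruence (q : ℕ) .{{_ : NonZero q}} where

  infix 4 _≈_
  _≈_ : ℕ → ℕ → Set
  x ≈ y = x % q ≡ y % q

  %-≈ : ∀ x → x % q ≈ x
  %-≈ x = m%n%n≡m%n x q

  +-cong : ∀ {x y u v} → x ≈ y → u ≈ v → x + u ≈ y + v
  +-cong {x} {y} {u} {v} x≈y u≈v = begin
    (x + u) % q             ≡⟨ %-distribˡ-+ x u q ⟩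
    (x % q + u % q) % q     ≡⟨ cong₂ (λ s t → (s + t) % q) x≈y u≈v ⟩
    (y % q + v % q) % q     ≡⟨ %-distribˡ-+ y v q ⟨
    (y + v) % q             ∎
    where open ≡-Reasoning

  *-cong : ∀ {x y u v} → x ≈ y → u ≈ v → x * u ≈ y * v
  *-cong {x} {y} {u} {v} x≈y u≈v = begin
    (x * u) % q             ≡⟨ %-distribˡ-* x u q ⟩
    (x % q * (u % q)) % q   ≡⟨ cong₂ (λ s t → (s * t) % q) x≈y u≈v ⟩
    (y % q * (v % q)) % q   ≡⟨ %-distribˡ-* y v q ⟨
    (y * v) % q             ∎
    where open ≡-Reasoning

  ^-cong : ∀ {x y} → x ≈ y → ∀ n → x ^ n ≈ y ^ n
  ^-cong x≈y zero    = refl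
  ^-cong x≈y (suc n) = *-cong x≈y (^-cong x≈y n)

  ∣⇒≈0 : ∀ {x} → q ∣ x → x ≈ 0
  ∣⇒≈0 {x} q∣x = trans (n∣m⇒m%n≡0 x q q∣x) (sym (n∣m⇒m%n≡0 0 q (q ∣0)))

  ≈⇒∣⇔∣ : ∀ {x y} → x ≈ y → q ∣ x ⇔ q ∣ y
  ≈⇒∣⇔∣ {x} {y} x≈y = mk⇔
    (λ q∣x → m%n≡0⇒n∣m y q (trans (sym x≈y) (n∣m⇒m%n≡0 x q q∣x)))
    (λ q∣y → m%n≡0⇒n∣m x q (trans x≈y (n∣m⇒m%n≡0 y q q∣y)))

  ≈⇒≈1⇔≈1 : ∀ {x y} → x ≈ y → x ≈ 1 ⇔ y ≈ 1
  ≈⇒≈1⇔≈1 x≈y = mk⇔ (trans (sym x≈y)) (trans x≈y)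

  ≈⇒∣∸ : ∀ {x y} → x ≈ y → q ∣ x ∸ y
  ≈⇒∣∸ {x} {y} x≈y = divides (x / q ∸ y / q) (begin
    x ∸ y
      ≡⟨ cong₂ _∸_ (m≡m%n+[m/n]*n x q) (m≡m%n+[m/n]*n y q) ⟩
    (x % q + x / q * q) ∸ (y % q + y / q * q)
      ≡⟨ cong (λ r → (r + x / q * q) ∸ (y % q + y / q * q)) x≈y ⟩
    (y % q + x / q * q) ∸ (y % q + y / q * q)
      ≡⟨ [m+n]∸[m+o]≡n∸o (y % q) (x / q * q) (y / q * q) ⟩
    x / q * q ∸ y / q * q
      ≡⟨ *-distribʳ-∸ q (x / q) (y / q) ⟨
    (x / q ∸ y / q) * q
      ∎)
    where open ≡-Reasoning

  ≤-∣∸⇒≈ : ∀ {x y} → y ≤ x → q ∣ x ∸ y → x ≈ y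
  ≤-∣∸⇒≈ {x} {y} y≤x q∣x∸y = begin
    x % q             ≡⟨ cong (_% q) (m+[n∸m]≡n y≤x) ⟨
    (y + (x ∸ y)) % q ≡⟨ %-remove-+ʳ y q∣x∸y ⟩
    y % q             ∎
    where open ≡-Reasoning

  ∣∸⇒≈ : ∀ {x y} → q ∣ x ∸ y → q ∣ y ∸ x → x ≈ y
  ∣∸⇒≈ {x} {y} q∣x∸y q∣y∸x with ≤-total y x
  ... | inj₁ y≤x = ≤-∣∸⇒≈ y≤x q∣x∸y
  ... | inj₂ x≤y = sym (≤-∣∸⇒≈ x≤y q∣y∸x)

  +-cancelˡ-≈ : ∀ c {x y} → c + x ≈ c + y → x ≈ y
  +-cancelˡ-≈ c {x} {y} c+x≈c+y = ∣∸⇒≈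
    (subst (q ∣_) ([m+n]∸[m+o]≡n∸o c x y) (≈⇒∣∸ c+x≈c+y))
    (subst (q ∣_) ([m+n]∸[m+o]≡n∸o c y x) (≈⇒∣∸ (sym c+x≈c+y)))

  <-≈⇒≡ : ∀ {x y} → x < q → y < q → x ≈ y → x ≡ y
  <-≈⇒≡ {x} {y} x<q y<q x≈y = begin
    x     ≡⟨ m<n⇒m%n≡m x<q ⟨
    x % q ≡⟨ x≈y ⟩
    y % q ≡⟨ m<n⇒m%n≡m y<q ⟩
    y     ∎
    where open ≡-Reasoning

  product-map-cong : ∀ {f g : ℕ → ℕ} → (∀ x → f x ≈ g x) →
                     ∀ xs → product (map f xs) ≈ product (map g xs)
  product-map-cong f≈g []       = refl
  product-map-cong f≈g (x ∷ xs) = *-cong (f≈g x) (product-map-cong f≈g xs)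

module PrimeModulus {q : ℕ} (q-prime : Prime q) where

  instance
    q≢0 : NonZero q
    q≢0 = prime⇒nonZero q-prime

  open Congruence q public

  q∤1 : ¬ q ∣ 1
  q∤1 q∣1 = ¬prime[1] (subst Prime (∣1⇒≡1 q∣1) q-prime)

  ∤-product : ∀ {xs} → All (λ x → ¬ q ∣ x) xs → ¬ q ∣ product xs
  ∤-product []                       = q∤1
  ∤-product {x ∷ xs} (q∤x ∷ q∤xs) q∣x*xs with euclidsLemma x (product xs) q-prime q∣x*xs
  ... | inj₁ q∣x  = q∤x q∣x
  ... | inj₂ q∣xs = ∤-product q∤xs q∣xs

  ∤-^ : ∀ {x} → ¬ q ∣ x → ∀ n → ¬ q ∣ x ^ n
  ∤-^ q∤x zero        = q∤1
  ∤-^ {x} q∤x (suc n) q∣x*x^n with euclidsLemma x (x ^ n) q-prime q∣x*x^n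
  ... | inj₁ q∣x   = q∤x q∣x
  ... | inj₂ q∣x^n = ∤-^ q∤x n q∣x^n

  *-cancelʳ-≈ : ∀ {u v} c → u * c ≈ v * c → u ≈ v ⊎ q ∣ c
  *-cancelʳ-≈ {u} {v} c uc≈vc
    with euclidsLemma (u ∸ v) c q-prime (subst (q ∣_) (sym (*-distribʳ-∸ c u v)) (≈⇒∣∸ uc≈vc))
       | euclidsLemma (v ∸ u) c q-prime (subst (q ∣_) (sym (*-distribʳ-∸ c v u)) (≈⇒∣∸ (sym uc≈vc)))
  ... | inj₂ q∣c   | _          = inj₂ q∣c
  ... | inj₁ _     | inj₂ q∣c   = inj₂ q∣c
  ... | inj₁ q∣u∸v | inj₁ q∣v∸u = inj₁ (∣∸⇒≈ q∣u∸v q∣v∸u)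

  *-cancelˡ-≈ : ∀ c {u v} → c * u ≈ c * v → u ≈ v ⊎ q ∣ c
  *-cancelˡ-≈ c {u} {v} cu≈cv = *-cancelʳ-≈ c (subst₂ _≈_ (*-comm c u) (*-comm c v) cu≈cv)

  nonzeroResidues : List ℕ
  nonzeroResidues = applyUpTo suc (q ∸ 1)

  ∈-nonzeroResidues⁺ : ∀ {z} → .{{NonZero z}} → z < q → z ∈ nonzeroResidues
  ∈-nonzeroResidues⁺ {suc i} 1+i<q =
    ∈-applyUpTo⁺ suc (subst (i <_) (pred[m∸n]≡m∸[1+n] q 0) (suc[m]≤n⇒m≤pred[n] 1+i<q))

  ∈-nonzeroResidues⁻ : ∀ {z} → z ∈ nonzeroResidues → z < q × ¬ q ∣ z
  ∈-nonzeroResidues⁻ z∈ with i , i<q∸1 , refl ← ∈-applyUpTo⁻ suc z∈ =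
    1+i<q , >⇒∤ 1+i<q
    where
    1+i<q : suc i < q
    1+i<q = m≤pred[n]⇒suc[m]≤n (subst (i <_) (sym (pred[m∸n]≡m∸[1+n] q 0)) i<q∸1)

  Unique-nonzeroResidues : Unique nonzeroResidues
  Unique-nonzeroResidues = applyUpTo⁺₁ suc (q ∸ 1) (λ i<j _ → <⇒≢ i<j ∘ suc-injective)

  map-*%-nonzeroResidues-↭ : ∀ {a} → ¬ q ∣ a →
                             map (λ i → a * i % q) nonzeroResidues ↭ nonzeroResidues
  map-*%-nonzeroResidues-↭ {a} q∤a = Unique-⊆-length≤⇒↭
    (Unique-map⁺-local injective Unique-nonzeroResidues) ⊆-nonzeroResidues
    (≤-reflexive (sym (length-map _ nonzeroResidues)))
    where
    injective : ∀ {x y} → x ∈ nonzeroResidues → y ∈ nonzeroResidues → a * x % q ≡ a * y % q → x ≡ y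
    injective x∈ y∈ ax≈ay with *-cancelˡ-≈ a ax≈ay
    ... | inj₁ x≈y = <-≈⇒≡ (proj₁ (∈-nonzeroResidues⁻ x∈)) (proj₁ (∈-nonzeroResidues⁻ y∈)) x≈y
    ... | inj₂ q∣a = ⊥-elim (q∤a q∣a)

    ⊆-nonzeroResidues : map (λ i → a * i % q) nonzeroResidues ⊆ nonzeroResidues
    ⊆-nonzeroResidues z∈ with i , i∈ , refl ← ∈-map⁻ _ z∈ =
      ∈-nonzeroResidues⁺ {{≢-nonZero ai%q≢0}} (m%n<n (a * i) q)
      where
      ai%q≢0 : a * i % q ≢ 0
      ai%q≢0 ai%q≡0 with euclidsLemma a i q-prime (m%n≡0⇒n∣m (a * i) q ai%q≡0)
      ... | inj₁ q∣a = q∤a q∣a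
      ... | inj₂ q∣i = proj₂ (∈-nonzeroResidues⁻ i∈) q∣i

  -- Multiplication by a permutes the nonzero residues, so it does not change their product.
  fermat : ∀ {a} → ¬ q ∣ a → a ^ (q ∸ 1) ≈ 1
  fermat {a} q∤a = [ id , ⊥-elim ∘ q∤P ]′ (*-cancelʳ-≈ (product R) a^[q-1]*P≈1*P)
    where
    R : List ℕ
    R = nonzeroResidues

    q∤P : ¬ q ∣ product R
    q∤P = ∤-product (All.tabulate (proj₂ ∘ ∈-nonzeroResidues⁻))

    a^[q-1]*P≈1*P : a ^ (q ∸ 1) * product R ≈ 1 * product R
    a^[q-1]*P≈1*P = begin
      (a ^ (q ∸ 1) * product R) % q
        ≡⟨ cong (λ n → (a ^ n * product R) % q) (length-applyUpTo suc (q ∸ 1)) ⟨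
      (a ^ length R * product R) % q
        ≡⟨ cong (_% q) (product-map-*ˡ a R) ⟨
      product (map (a *_) R) % q
        ≡⟨ product-map-cong (λ i → sym (%-≈ (a * i))) R ⟩
      product (map (λ i → a * i % q) R) % q
        ≡⟨ cong (_% q) (product-↭ (map-*%-nonzeroResidues-↭ q∤a)) ⟩
      product R % q
        ≡⟨ cong (_% q) (*-identityˡ (product R)) ⟨
      (1 * product R) % q
        ∎
      where open ≡-Reasoning

  ^≈1 : ∀ {x} → x ≈ 1 → ∀ n → x ^ n ≈ 1
  ^≈1 {x} x≈1 n = trans (^-cong x≈1 n) (cong (_% q) (^-zeroˡ n))

  ^1≈1⇒≈1 : ∀ {x} → x ^ 1 ≈ 1 → x ≈ 1
  ^1≈1⇒≈1 {x} = subst (_≈ 1) (*-identityʳ x)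

  ≈1⇒^1≈1 : ∀ {x} → x ≈ 1 → x ^ 1 ≈ 1
  ≈1⇒^1≈1 {x} = subst (_≈ 1) (sym (*-identityʳ x))

  ^≈1-∣ : ∀ {x d e} → x ^ d ≈ 1 → d ∣ e → x ^ e ≈ 1
  ^≈1-∣ {x} {d} {e} x^d≈1 (divides t e≡t*d) = begin
    x ^ e % q       ≡⟨ cong (λ n → x ^ n % q) (trans e≡t*d (*-comm t d)) ⟩
    x ^ (d * t) % q ≡⟨ cong (_% q) (^-*-assoc x d t) ⟨
    (x ^ d) ^ t % q ≡⟨ ^≈1 x^d≈1 t ⟩
    1 % q           ∎
    where open ≡-Reasoning

  ^≈1-+-cancelˡ : ∀ {x} → ¬ q ∣ x → ∀ s {t} → x ^ (s + t) ≈ 1 → x ^ s ≈ 1 → x ^ t ≈ 1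
  ^≈1-+-cancelˡ {x} q∤x s {t} x^[s+t]≈1 x^s≈1 =
    [ id , ⊥-elim ∘ ∤-^ q∤x s ]′ (*-cancelˡ-≈ (x ^ s) x^s*x^t≈x^s*1)
    where
    x^s*x^t≈x^s*1 : x ^ s * x ^ t ≈ x ^ s * 1
    x^s*x^t≈x^s*1 = begin
      x ^ s * x ^ t % q ≡⟨ cong (_% q) (^-distribˡ-+-* x s t) ⟨
      x ^ (s + t) % q   ≡⟨ trans x^[s+t]≈1 (sym x^s≈1) ⟩
      x ^ s % q         ≡⟨ cong (_% q) (*-identityʳ (x ^ s)) ⟨
      x ^ s * 1 % q     ∎
      where open ≡-Reasoning

  ^≈1-gcd : ∀ {x} → ¬ q ∣ x → ∀ {m n} → x ^ m ≈ 1 → x ^ n ≈ 1 → x ^ gcd m n ≈ 1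
  ^≈1-gcd {x} q∤x {m} {n} x^m≈1 x^n≈1 with Bézout.identity (gcd-GCD m n)
  ... | Bézout.+- i j g+jn≡im = ^≈1-+-cancelˡ q∤x (j * n)
          (^≈1-∣ x^m≈1 (divides i (trans (+-comm (j * n) (gcd m n)) g+jn≡im)))
          (^≈1-∣ x^n≈1 (divides j refl))
  ... | Bézout.-+ i j g+im≡jn = ^≈1-+-cancelˡ q∤x (i * m)
          (^≈1-∣ x^n≈1 (divides j (trans (+-comm (i * m) (gcd m n)) g+im≡jn)))
          (^≈1-∣ x^m≈1 (divides i refl))

  ^[k*j]≈1⇔^[gcd[k,m]*j]≈1 : ∀ {x} → ¬ q ∣ x → ∀ {m} → x ^ m ≈ 1 → ∀ k j →
                             x ^ (k * j) ≈ 1 ⇔ x ^ (gcd k m * j) ≈ 1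
  ^[k*j]≈1⇔^[gcd[k,m]*j]≈1 {x} q∤x {m} x^m≈1 k j = mk⇔
    (λ x^kj≈1 → subst (λ e → x ^ e ≈ 1) gcd[kj,mj]≡gcd[k,m]*j
                  (^≈1-gcd q∤x {k * j} {m * j} x^kj≈1 (^≈1-∣ {d = m} x^m≈1 (m∣m*n j))))
    (λ x^gj≈1 → ^≈1-∣ x^gj≈1 (*-monoˡ-∣ j (gcd[m,n]∣m k m)))
    where
    gcd[kj,mj]≡gcd[k,m]*j : gcd (k * j) (m * j) ≡ gcd k m * j
    gcd[kj,mj]≡gcd[k,m]*j = begin
      gcd (k * j) (m * j) ≡⟨ cong₂ gcd (*-comm k j) (*-comm m j) ⟩
      gcd (j * k) (j * m) ≡⟨ c*gcd[m,n]≡gcd[cm,cn] j k m ⟨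
      j * gcd k m         ≡⟨ *-comm j (gcd k m) ⟩
      gcd k m * j         ∎
      where open ≡-Reasoning

  geometricSum-≈ : ∀ {y} → y ≈ 1 → ∀ a → geometricSum y a ≈ suc a
  geometricSum-≈ y≈1 zero    = refl
  geometricSum-≈ y≈1 (suc a) = +-cong (^≈1 y≈1 (suc a)) (geometricSum-≈ y≈1 a)

  ∣geometricSum⇔^≈1 : ∀ {y} → ¬ y ≈ 1 → ∀ a → q ∣ geometricSum y a ⇔ y ^ suc a ≈ 1
  ∣geometricSum⇔^≈1 {y} y≉1 a = mk⇔ to from
    where
    G : ℕ
    G = geometricSum y a

    to : q ∣ G → y ^ suc a ≈ 1
    to q∣G = begin
      y ^ suc a % q       ≡⟨ %-remove-+ˡ (y ^ suc a) q∣G ⟨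
      (G + y ^ suc a) % q ≡⟨ cong (_% q) (geometricSum-telescope y a) ⟨
      (1 + G * y) % q     ≡⟨ %-remove-+ʳ 1 (∣m⇒∣m*n y q∣G) ⟩
      1 % q               ∎
      where open ≡-Reasoning

    from : y ^ suc a ≈ 1 → q ∣ G
    from y^[1+a]≈1 = [ ⊥-elim ∘ y≉1 , id ]′ (*-cancelˡ-≈ G (+-cancelˡ-≈ 1 1+Gy≈1+G*1))
      where
      1+Gy≈1+G*1 : 1 + G * y ≈ 1 + G * 1
      1+Gy≈1+G*1 = begin
        (1 + G * y) % q     ≡⟨ cong (_% q) (geometricSum-telescope y a) ⟩
        (G + y ^ suc a) % q ≡⟨ +-cong {G} refl y^[1+a]≈1 ⟩
        (G + 1) % q         ≡⟨ cong (_% q) (trans (+-comm G 1) (cong suc (sym (*-identityʳ G)))) ⟩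
        (1 + G * 1) % q     ∎
        where open ≡-Reasoning

  ∣geometricSum-cong : ∀ {y z} → (∀ j → y ^ j ≈ 1 ⇔ z ^ j ≈ 1) →
                       ∀ a → q ∣ geometricSum y a ⇔ q ∣ geometricSum z a
  ∣geometricSum-cong {y} {z} y^≈1⇔z^≈1 a with y % q ≟ 1 % q
  ... | yes y≈1 = ≈⇒∣⇔∣ (trans (geometricSum-≈ y≈1 a) (sym (geometricSum-≈ z≈1 a)))
    where
    z≈1 : z ≈ 1
    z≈1 = ^1≈1⇒≈1 (Equivalence.to (y^≈1⇔z^≈1 1) (≈1⇒^1≈1 y≈1))
  ... | no y≉1 =
    ⇔-sym (∣geometricSum⇔^≈1 z≉1 a) ⇔-∘ (y^≈1⇔z^≈1 (suc a) ⇔-∘ ∣geometricSum⇔^≈1 y≉1 a)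
    where
    z≉1 : ¬ z ≈ 1
    z≉1 = y≉1 ∘ ^1≈1⇒≈1 ∘ Equivalence.from (y^≈1⇔z^≈1 1) ∘ ≈1⇒^1≈1

  ^k≈1⇔^gcd[k,q-1]≈1 : ∀ {k} → .{{NonZero k}} → ∀ p j →
                       (p ^ k) ^ j ≈ 1 ⇔ (p ^ gcd k (q ∸ 1)) ^ j ≈ 1
  ^k≈1⇔^gcd[k,q-1]≈1 {k} p j with q ∣? p
  ... | yes q∣p = ≈⇒≈1⇔≈1 (^-cong (trans (∣⇒≈0 (∣⇒∣^ k q∣p)) (sym (∣⇒≈0 (∣⇒∣^ g q∣p)))) j)
    where
    g : ℕ
    g = gcd k (q ∸ 1)
    instance
      g≢0 : NonZero g
      g≢0 = ≢-nonZero (gcd[m,n]≢0 k (q ∸ 1) (inj₁ (≢-nonZero⁻¹ k)))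
  ... | no q∤p =
    subst₂ (λ s t → s ≈ 1 ⇔ t ≈ 1) (sym (^-*-assoc p k j)) (sym (^-*-assoc p (gcd k (q ∸ 1)) j))
      (^[k*j]≈1⇔^[gcd[k,m]*j]≈1 q∤p (fermat q∤p) k j)

  ∣σ⇔∣σgcd-prime-power : ∀ k → .{{NonZero k}} → ∀ {p} → Prime p → ∀ a →
                    q ∣ σ k (p ^ a) ⇔ q ∣ σ (gcd k (q ∸ 1)) (p ^ a)
  ∣σ⇔∣σgcd-prime-power k {p} p-prime a =
    subst₂ (λ s t → q ∣ s ⇔ q ∣ t)
      (sym (σ[p^a]≡geometricSum p-prime k a)) (sym (σ[p^a]≡geometricSum p-prime (gcd k (q ∸ 1)) a))
      (∣geometricSum-cong (^k≈1⇔^gcd[k,q-1]≈1 p) a)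

proposition1 : (q k : ℕ) → Prime q → 1 ≤ k → (n : ℕ) → 0 < n →
    (q ∣ σ k n) ⇔ (q ∣ σ (gcd k (q ∸ 1)) n)
proposition1 q k q-prime 1≤k n 0<n = mk⇔
  (∣-transfer-multiplicative q-prime (σ-multiplicative k) (σ-multiplicative g)
     (λ p-prime a → Equivalence.to (∣σ⇔∣σgcd-prime-power k p-prime a)) n)
  (∣-transfer-multiplicative q-prime (σ-multiplicative g) (σ-multiplicative k)
     (λ p-prime a → Equivalence.from (∣σ⇔∣σgcd-prime-power k p-prime a)) n)
  where
  open PrimeModulus q-prime using (∣σ⇔∣σgcd-prime-power)
  g : ℕ
  g = gcd k (q ∸ 1)
  instance
    k≢0 : NonZero k
    k≢0 = >-nonZero 1≤k
    n≢0 : NonZero n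
    n≢0 = >-nonZero 0<n
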